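{- Let $m$ be a positive integer and let $\alpha,\beta\in\mathbb{F}_{2^{2m}}$ be such that either (i) $\alpha=\beta$ and $\alpha^{2^m}+\alpha^{2^m-1}+1=0$, or (ii) $\beta=\alpha+1$, $\alpha^{2^m+1}=1$ and $\alpha\neq 1$. Consider the triple of maps $\mathbb{F}_{2^{6m}}\to\mathbb{F}_{2^{6m}}$ $$(\Phi_1,\Phi_2,\Phi_3)=\left(x^{2^{m}},\ \alpha x^{2^m}+\beta x^{2^{3m}}+(\alpha+1)x^{2^{5m}},\ (\alpha+1)x^{2^m}+\beta x^{2^{3m}}+\alpha x^{2^{5m}}\right).$$ Then $\Phi_1,\Phi_2,\Phi_3$ are permutations of $\mathbb{F}_{2^{6m}}$, the triple satisfies property $(\mathcal{A}_{6m})$, and $E^{\cup}\neq\mathbb{F}_{2^{6m}}$.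
   Context: For a positive integer $n$ and $q=2^n$, three permutations $\Phi_1,\Phi_2,\Phi_3$ of $\mathbb{F}_q$ are said to satisfy property $(\mathcal{A}_n)$ if (1) $\Psi=\Phi_1+\Phi_2+\Phi_3$ is a permutation of $\mathbb{F}_q$, and (2) $\Psi^{ -1}=\Phi_1^{ -1}+\Phi_2^{ -1}+\Phi_3^{ -1}$ (sums are pointwise sums of functions, inverses are compositional inverses). For $1\le i<j\le 3$, $E_{i,j}=\{x\in\mathbb{F}_q:\Phi_i(x)=\Phi_j(x)\}$ and $E^{\cup}=E_{1,2}\cup E_{1,3}\cup E_{2,3}$. -}

module Defs where

open import Level using (Level; suc; zero)
open import Data.Nat as ℕ using (ℕ)
open import Data.Fin using (Fin)
open import Data.Product using (Σ; ∃; _×_; _,_)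
open import Relation.Binary.PropositionalEquality using (_≡_; _≢_)
open import Relation.Nullary using (¬_)
open import Algebra.Structures using (IsCommutativeRing)
open import Function.Bundles using (_↔_)
open import Function.Definitions using (Bijective)
open import Data.Sum using (_⊎_)

record FiniteField (q : ℕ) : Set₁ where
  infixl 6 _+_
  infixl 7 _*_
  field
    Carrier : Set
    _+_ _*_ : Carrier → Carrier → Carrier
    -_      : Carrier → Carrier
    0# 1#   : Carrier
    isCommutativeRing : IsCommutativeRing _≡_ _+_ _*_ -_ 0# 1#
    0≢1     : 0# ≢ 1#
    inverse : ∀ x → x ≢ 0# → ∃ λ y → x * y ≡ 1#
    card    : Carrier ↔ Fin q

  infixr 8 _^_
  _^_ : Carrier → ℕ → Carrier
  x ^ ℕ.zero  = 1#
  x ^ ℕ.suc k = x * (x ^ k)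

  IsPermutation : (Carrier → Carrier) → Set
  IsPermutation f = Bijective _≡_ _≡_ f

  InverseOf : (Carrier → Carrier) → (Carrier → Carrier) → Set
  InverseOf g f = (∀ x → g (f x) ≡ x) × (∀ x → f (g x) ≡ x)

  Sum3 : (Carrier → Carrier) → (Carrier → Carrier) → (Carrier → Carrier) → Carrier → Carrier
  Sum3 f g h x = f x + g x + h x

  PropertyA : (Carrier → Carrier) → (Carrier → Carrier) → (Carrier → Carrier) → Set
  PropertyA Φ₁ Φ₂ Φ₃ =
    IsPermutation (Sum3 Φ₁ Φ₂ Φ₃) ×
    (Σ (Carrier → Carrier) λ g₁ → Σ (Carrier → Carrier) λ g₂ → Σ (Carrier → Carrier) λ g₃ →
     Σ (Carrier → Carrier) λ h →
       InverseOf g₁ Φ₁ × InverseOf g₂ Φ₂ × InverseOf g₃ Φ₃ × InverseOf h (Sum3 Φ₁ Φ₂ Φ₃) ×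
       (∀ x → h x ≡ g₁ x + g₂ x + g₃ x))

  InEUnion : (Carrier → Carrier) → (Carrier → Carrier) → (Carrier → Carrier) → Carrier → Set
  InEUnion Φ₁ Φ₂ Φ₃ x = (Φ₁ x ≡ Φ₂ x) ⊎ (Φ₁ x ≡ Φ₃ x) ⊎ (Φ₂ x ≡ Φ₃ x)

-- Write σ x = x^(2^m) and τ = σ², an automorphism of order 3 of F = F_(2^(6m)) that fixes α and β.
-- With L(a, b, c) z = a z + b τz + c τ²z we have Φ₁ = σ, Φ₂ = L(α, β, α+1) ∘ σ and Φ₃ = L(α+1, β, α) ∘ σ.
-- For τ-fixed coefficients these maps compose like 3×3 circulant matrices, so L(a, b, c) is inverted by
-- its adjugate divided by a³ + b³ + c³ + abc, which equals β + 1 ≠ 0 for both L₂ and L₃.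
-- In characteristic 2, Ψ = Φ₁ + Φ₂ + Φ₃ = τ²σ = σ⁻¹, while the inverses of L₂ and L₃ add up to τ + 1,
-- so Φ₁⁻¹ + Φ₂⁻¹ + Φ₃⁻¹ = σ⁻¹(1 + L₂⁻¹ + L₃⁻¹) = σ⁻¹τ = σ = Ψ⁻¹.
-- Finally, after substituting y = σ x each E_ij is the zero set of a trinomial a y + b y^(2^(2m)) + c y^(2^(4m))
-- with c ≠ 0, so |E^∪| ≤ 3·2^(4m) < 2^(6m). The two conditions on α are needed only to exclude α ∈ {0, 1}.
module Submission where

open import Defs
open import Data.Nat using (ℕ; _≤_; _∸_)
open import Data.Nat using () renaming (_+_ to _+ℕ_; _*_ to _*ℕ_; _^_ to _^ℕ_)
open import Data.Product using (_×_)
open import Data.Sum using (_⊎_)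
open import Relation.Binary.PropositionalEquality using (_≡_; _≢_)
open import Relation.Nullary using (¬_)

open import Level using (0ℓ)
open import Algebra.Bundles using (CommutativeRing; CommutativeMonoid)
import Algebra.Properties.CommutativeMonoid.Sum as MonoidSum
import Algebra.Properties.CommutativeSemiring.Exp as CommutativeSemiringExp
import Algebra.Properties.Group as GroupProperties
import Algebra.Properties.Semiring.Exp as SemiringExp
import Algebra.Properties.Semiring.Mult as SemiringMult
open import Algebra.Solver.Ring.AlmostCommutativeRing using (fromCommutativeRing; _-Raw-AlmostCommutative⟶_)
open import Data.Bool using (Bool; true; false; _xor_; _∧_)
open import Data.Bool.Properties using (xor-∧-commutativeRing) renaming (_≟_ to _≟ᵇ_)
open import Data.Empty using (⊥-elim)
open import Data.Fin using (Fin; punchIn)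
import Data.Fin.Properties as Fin
open import Data.Fin.Permutation using (Permutation)
open import Data.List using (List; []; _∷_; length; filter; allFin)
import Data.List as List
import Data.List.Properties as List
open import Data.List.Relation.Unary.All as All using (All; []; _∷_)
import Data.List.Relation.Unary.All.Properties as All
open import Data.List.Relation.Unary.AllPairs using ([]; _∷_)
open import Data.List.Relation.Unary.Unique.Propositional using (Unique)
import Data.List.Relation.Unary.Unique.Propositional.Properties as Unique
open import Data.Maybe using (Maybe; just; nothing)
open import Data.Nat using (zero; suc; pred; NonZero; >-nonZero; z≤n; s≤s; _<_)
import Data.Nat.Properties as ℕ
open import Data.Nat.Tactic.RingSolver using () renaming (solve to solveℕ)
open import Data.Product using (Σ; _,_; proj₁; proj₂)
import Data.Sum as Sum
open import Data.Sum using (inj₁; inj₂; [_,_]′)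
open import Data.Vec.Functional using (Vector; removeAt)
open import Function using (_∘_; id; Inverse; mk↔ₛ′)
open import Function.Bundles using (Bijection)
open import Function.Construct.Composition using (_↔-∘_)
open import Function.Construct.Symmetry using (↔-sym)
open import Function.Properties.Inverse using (↔⇒⤖; ↔⇒↣)
open import Relation.Binary.Definitions using (DecidableEquality)
open import Relation.Binary.PropositionalEquality using (refl; sym; trans; cong; cong₂; subst; module ≡-Reasoning)
open import Relation.Nullary using (yes; no)
open import Relation.Nullary.Decidable using (via-injection)
open import Relation.Unary using (Pred; Decidable; _∪_)
open import Relation.Unary.Properties using (_∪?_)

module _ {a p} {A : Set a} {P Q : Pred A p} (P? : Decidable P) (Q? : Decidable Q) where

  length-≤-filter-∪ : ∀ {xs} → All (P ∪ Q) xs → length xs ≤ length (filter P? xs) +ℕ length (filter Q? xs)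
  length-≤-filter-∪ [] = z≤n
  length-≤-filter-∪ {x ∷ xs} (Px⊎Qx ∷ rest) with P? x | Q? x | length-≤-filter-∪ rest
  ... | yes _   | yes _   | ih = s≤s (ℕ.≤-trans ih (ℕ.+-monoʳ-≤ _ (ℕ.n≤1+n _)))
  ... | yes _   | no _    | ih = s≤s ih
  ... | no _    | yes _   | ih = subst (suc (length xs) ≤_) (sym (ℕ.+-suc _ _)) (s≤s ih)
  ... | no ¬Px  | no ¬Qx  | _  = ⊥-elim ([ ¬Px , ¬Qx ]′ Px⊎Qx)

module FiniteFieldProperties {q : ℕ} (F : FiniteField q) where
  open FiniteField F
  open ≡-Reasoning

  commutativeRing : CommutativeRing 0ℓ 0ℓ
  commutativeRing = record { isCommutativeRing = isCommutativeRing }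

  open CommutativeRing commutativeRing public
    using ( +-identityˡ; +-identityʳ; *-comm; *-assoc; *-identityˡ; *-identityʳ; zeroˡ; zeroʳ
          ; +-commutativeMonoid; *-commutativeMonoid; semiring; commutativeSemiring; +-group)

  private
    toFin : Carrier → Fin q
    toFin = Inverse.to card

    fromFin : Fin q → Carrier
    fromFin = Inverse.from card

  infix 4 _≟_
  _≟_ : DecidableEquality Carrier
  _≟_ = via-injection (↔⇒↣ card) Fin._≟_

  elements : List Carrier
  elements = List.map fromFin (allFin q)

  elements-unique : Unique elements
  elements-unique = Unique.map⁺ (Bijection.injective (↔⇒⤖ (↔-sym card))) (Unique.allFin⁺ q)

  length-elements : length elements ≡ q
  length-elements = trans (List.length-map fromFin (allFin q)) (List.length-tabulate id)

  InverseOf⇒IsPermutation : ∀ {f g} → InverseOf g f → IsPermutation f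
  InverseOf⇒IsPermutation {f} {g} (gf , fg) = Bijection.bijective (↔⇒⤖ (mk↔ₛ′ f g fg gf))

  InverseOf-∘ : ∀ {f g f′ g′} → InverseOf g f → InverseOf g′ f′ → InverseOf (g ∘ g′) (f′ ∘ f)
  InverseOf-∘ {f} {g} {f′} {g′} (gf , fg) (g′f′ , f′g′) =
    (λ x → trans (cong g (g′f′ (f x))) (gf x)) , (λ y → trans (cong f′ (fg (g′ y))) (f′g′ y))

  InverseOf-≗ : ∀ {f f′ g} → (∀ x → f x ≡ f′ x) → InverseOf g f → InverseOf g f′
  InverseOf-≗ {f} {f′} {g} f≗f′ (gf , fg) =
    (λ x → trans (cong g (sym (f≗f′ x))) (gf x)) , (λ y → trans (sym (f≗f′ (g y))) (fg y))

  1≢0 : 1# ≢ 0#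
  1≢0 = 0≢1 ∘ sym

  scaling-inverse : ∀ {a a⁻¹} → a * a⁻¹ ≡ 1# → InverseOf (a⁻¹ *_) (a *_)
  scaling-inverse {a} {a⁻¹} aa⁻¹≡1 = cancel a⁻¹ a (trans (*-comm a⁻¹ a) aa⁻¹≡1) , cancel a a⁻¹ aa⁻¹≡1
    where
    cancel : ∀ u v → u * v ≡ 1# → ∀ x → u * (v * x) ≡ x
    cancel u v uv≡1 x = begin
      u * (v * x)  ≡⟨ sym (*-assoc u v x) ⟩
      (u * v) * x  ≡⟨ cong (_* x) uv≡1 ⟩
      1# * x       ≡⟨ *-identityˡ x ⟩
      x            ∎

  translation-inverse : ∀ c → InverseOf (_+ - c) (_+ c)
  translation-inverse c = //-rightDividesʳ c , //-rightDividesˡ c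
    where open GroupProperties +-group

  x*y≡0⇒x≡0⊎y≡0 : ∀ {x y} → x * y ≡ 0# → x ≡ 0# ⊎ y ≡ 0#
  x*y≡0⇒x≡0⊎y≡0 {x} {y} xy≡0 with x ≟ 0#
  ... | yes x≡0 = inj₁ x≡0
  ... | no x≢0 with inverse x x≢0
  ...   | x⁻¹ , xx⁻¹≡1 = inj₂ (begin
    y               ≡⟨ sym (proj₁ (scaling-inverse xx⁻¹≡1) y) ⟩
    x⁻¹ * (x * y)   ≡⟨ cong (x⁻¹ *_) xy≡0 ⟩
    x⁻¹ * 0#        ≡⟨ zeroʳ x⁻¹ ⟩
    0#              ∎)

  x≢0∧y≢0⇒x*y≢0 : ∀ {x y} → x ≢ 0# → y ≢ 0# → x * y ≢ 0#
  x≢0∧y≢0⇒x*y≢0 x≢0 y≢0 xy≡0 = [ x≢0 , y≢0 ]′ (x*y≡0⇒x≡0⊎y≡0 xy≡0)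

  *-cancelʳ-≢0 : ∀ {x y z} → z ≢ 0# → x * z ≡ y * z → x ≡ y
  *-cancelʳ-≢0 {x} {y} {z} z≢0 xz≡yz with inverse z z≢0
  ... | z⁻¹ , zz⁻¹≡1 = begin
    x                ≡⟨ sym (proj₁ (scaling-inverse zz⁻¹≡1) x) ⟩
    z⁻¹ * (z * x)    ≡⟨ cong (z⁻¹ *_) (trans (*-comm z x) (trans xz≡yz (*-comm y z))) ⟩
    z⁻¹ * (z * y)    ≡⟨ proj₁ (scaling-inverse zz⁻¹≡1) y ⟩
    y                ∎

  module Exp = SemiringExp semiring

  ^≡^ : ∀ x n → x ^ n ≡ x Exp.^ n
  ^≡^ x zero    = refl
  ^≡^ x (suc n) = cong (x *_) (^≡^ x n)

  ^-homo-* : ∀ x m n → x ^ (m +ℕ n) ≡ x ^ m * x ^ n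
  ^-homo-* x m n = begin
    x ^ (m +ℕ n)             ≡⟨ ^≡^ x (m +ℕ n) ⟩
    x Exp.^ (m +ℕ n)         ≡⟨ Exp.^-homo-* x m n ⟩
    x Exp.^ m * x Exp.^ n    ≡⟨ sym (cong₂ _*_ (^≡^ x m) (^≡^ x n)) ⟩
    x ^ m * x ^ n            ∎

  ^-assocʳ : ∀ x m n → (x ^ m) ^ n ≡ x ^ (m *ℕ n)
  ^-assocʳ x m n = begin
    (x ^ m) ^ n              ≡⟨ ^≡^ (x ^ m) n ⟩
    (x ^ m) Exp.^ n          ≡⟨ cong (Exp._^ n) (^≡^ x m) ⟩
    (x Exp.^ m) Exp.^ n      ≡⟨ Exp.^-assocʳ x m n ⟩
    x Exp.^ (m *ℕ n)         ≡⟨ sym (^≡^ x (m *ℕ n)) ⟩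
    x ^ (m *ℕ n)             ∎

  ^-distrib-* : ∀ x y n → (x * y) ^ n ≡ x ^ n * y ^ n
  ^-distrib-* x y n = begin
    (x * y) ^ n              ≡⟨ ^≡^ (x * y) n ⟩
    (x * y) Exp.^ n          ≡⟨ CommutativeSemiringExp.^-distrib-* commutativeSemiring x y n ⟩
    x Exp.^ n * y Exp.^ n    ≡⟨ sym (cong₂ _*_ (^≡^ x n) (^≡^ y n)) ⟩
    x ^ n * y ^ n            ∎

  1^n≡1 : ∀ n → 1# ^ n ≡ 1#
  1^n≡1 zero    = refl
  1^n≡1 (suc n) = trans (*-identityˡ _) (1^n≡1 n)

  0^n≡0 : ∀ n .{{_ : NonZero n}} → 0# ^ n ≡ 0#
  0^n≡0 (suc n) = zeroˡ _

  module FieldSum {c ℓ} (M : CommutativeMonoid c ℓ) where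
    open CommutativeMonoid M using (_≈_; _∙_) renaming (Carrier to A; reflexive to ≈-reflexive; trans to ≈-trans)
    open MonoidSum M using (sum; sum-permute; sum-cong-≋; ∑-distrib-+)

    ∑ : (Carrier → A) → A
    ∑ f = sum (f ∘ fromFin)

    ∑-distrib : ∀ (f g : Carrier → A) → ∑ (λ x → f x ∙ g x) ≈ ∑ f ∙ ∑ g
    ∑-distrib f g = ∑-distrib-+ (f ∘ fromFin) (g ∘ fromFin)

    ∑-cong : ∀ {f g : Carrier → A} → (∀ x → f x ≈ g x) → ∑ f ≈ ∑ g
    ∑-cong f≈g = sum-cong-≋ (f≈g ∘ fromFin)

    ∑-reindex : ∀ φ {ψ} → InverseOf ψ φ → ∀ f → ∑ f ≈ ∑ (f ∘ φ)
    ∑-reindex φ {ψ} (ψφ , φψ) f =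
      ≈-trans (sum-permute (f ∘ fromFin) π)
              (sum-cong-≋ {q} (λ i → ≈-reflexive (cong f (Inverse.strictlyInverseʳ card (φ (fromFin i))))))
      where
      π : Permutation q q
      π = card ↔-∘ (mk↔ₛ′ φ ψ φψ ψφ ↔-∘ ↔-sym card)

  open SemiringMult semiring using (×1-homo-*) renaming (_×_ to _×ₙ_)
  open FieldSum +-commutativeMonoid using (∑; ∑-reindex; ∑-distrib)
  open FieldSum *-commutativeMonoid using ()
    renaming (∑ to ∏; ∑-reindex to ∏-reindex; ∑-distrib to ∏-distrib; ∑-cong to ∏-cong)
  private
    module Π = MonoidSum *-commutativeMonoid

  q×1≡0 : q ×ₙ 1# ≡ 0#
  q×1≡0 = identityʳ-unique (∑ id) (q ×ₙ 1#) (sym (begin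
    ∑ id                    ≡⟨ ∑-reindex (_+ 1#) (translation-inverse 1#) id ⟩
    ∑ (λ x → x + 1#)        ≡⟨ ∑-distrib id (λ _ → 1#) ⟩
    ∑ id + ∑ (λ _ → 1#)     ≡⟨ cong (∑ id +_) (MonoidSum.sum-replicate +-commutativeMonoid q) ⟩
    ∑ id + q ×ₙ 1#          ∎))
    where open GroupProperties +-group using (identityʳ-unique)

  2^n×1≡0⇒1+1≡0 : ∀ n → (2 ^ℕ n) ×ₙ 1# ≡ 0# → 1# + 1# ≡ 0#
  2^n×1≡0⇒1+1≡0 zero    1+0≡0 = ⊥-elim (1≢0 (trans (sym (+-identityʳ 1#)) 1+0≡0))
  2^n×1≡0⇒1+1≡0 (suc n) 2^[1+n]×1≡0
    with x*y≡0⇒x≡0⊎y≡0 (trans (sym (×1-homo-* 2 (2 ^ℕ n))) 2^[1+n]×1≡0)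
  ... | inj₁ 2×1≡0   = trans (cong (1# +_) (sym (+-identityʳ 1#))) 2×1≡0
  ... | inj₂ 2^n×1≡0 = 2^n×1≡0⇒1+1≡0 n 2^n×1≡0

  characteristic-two : ∀ {n} → q ≡ 2 ^ℕ n → 1# + 1# ≡ 0#
  characteristic-two {n} refl = 2^n×1≡0⇒1+1≡0 n q×1≡0

  ∏≢0 : ∀ {f} → (∀ x → f x ≢ 0#) → ∏ f ≢ 0#
  ∏≢0 f≢0 = product≢0 _ (f≢0 ∘ fromFin)
    where
    product≢0 : ∀ {n} (v : Vector Carrier n) → (∀ i → v i ≢ 0#) → Π.sum v ≢ 0#
    product≢0 {zero}  v _   = 1≢0
    product≢0 {suc n} v v≢0 = x≢0∧y≢0⇒x*y≢0 (v≢0 Fin.zero) (product≢0 (v ∘ Fin.suc) (v≢0 ∘ Fin.suc))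

  nonzero-or-1 : Carrier → Carrier
  nonzero-or-1 x with x ≟ 0#
  ... | yes _ = 1#
  ... | no _  = x

  nonzero-or-1≢0 : ∀ x → nonzero-or-1 x ≢ 0#
  nonzero-or-1≢0 x with x ≟ 0#
  ... | yes _   = 1≢0
  ... | no x≢0  = x≢0

  module Fermat {a} (a≢0 : a ≢ 0#) where

    scaling-factor : Carrier → Carrier
    scaling-factor x with x ≟ 0#
    ... | yes _ = 1#
    ... | no _  = a

    nonzero-or-1-scale : ∀ x → nonzero-or-1 (a * x) ≡ scaling-factor x * nonzero-or-1 x
    nonzero-or-1-scale x with x ≟ 0# | a * x ≟ 0#
    ... | yes _   | yes _    = sym (*-identityˡ 1#)
    ... | yes x≡0 | no ax≢0  = ⊥-elim (ax≢0 (trans (cong (a *_) x≡0) (zeroʳ a)))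
    ... | no x≢0  | yes ax≡0 = ⊥-elim (x≢0∧y≢0⇒x*y≢0 a≢0 x≢0 ax≡0)
    ... | no _    | no _     = refl

    ∏scaling-factor≡1 : ∏ scaling-factor ≡ 1#
    ∏scaling-factor≡1 with inverse a a≢0
    ... | a⁻¹ , aa⁻¹≡1 = *-cancelʳ-≢0 (∏≢0 nonzero-or-1≢0) (begin
      ∏ scaling-factor * ∏ nonzero-or-1                   ≡⟨ sym (∏-distrib scaling-factor nonzero-or-1) ⟩
      ∏ (λ x → scaling-factor x * nonzero-or-1 x)         ≡⟨ sym (∏-cong nonzero-or-1-scale) ⟩
      ∏ (nonzero-or-1 ∘ (a *_))                           ≡⟨ sym (∏-reindex (a *_) (scaling-inverse aa⁻¹≡1) nonzero-or-1) ⟩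
      ∏ nonzero-or-1                                      ≡⟨ sym (*-identityˡ _) ⟩
      1# * ∏ nonzero-or-1                                 ∎)

    ∏scaling-factor≡a^[q-1] : ∀ {q′} → q ≡ suc q′ → ∏ scaling-factor ≡ a ^ q′
    ∏scaling-factor≡a^[q-1] {q′} refl = begin
      ∏ scaling-factor                                 ≡⟨ Π.sum-remove {i = toFin 0#} (scaling-factor ∘ fromFin) ⟩
      scaling-factor (fromFin (toFin 0#)) * Π.sum rest ≡⟨ cong₂ _*_ at-0 (Π.sum-cong-≋ elsewhere) ⟩
      1# * Π.sum {q′} (λ _ → a)                        ≡⟨ *-identityˡ _ ⟩
      Π.sum {q′} (λ _ → a)                             ≡⟨ Π.sum-replicate q′ ⟩
      a Exp.^ q′                                       ≡⟨ sym (^≡^ a q′) ⟩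
      a ^ q′                                           ∎
      where
      rest : Vector Carrier q′
      rest = removeAt (scaling-factor ∘ fromFin) (toFin 0#)
      at-0 : scaling-factor (fromFin (toFin 0#)) ≡ 1#
      at-0 with fromFin (toFin 0#) ≟ 0#
      ... | yes _ = refl
      ... | no ≢0 = ⊥-elim (≢0 (Inverse.strictlyInverseʳ card 0#))
      elsewhere : ∀ j → scaling-factor (fromFin (punchIn (toFin 0#) j)) ≡ a
      elsewhere j with fromFin (punchIn (toFin 0#) j) ≟ 0#
      ... | no _   = refl
      ... | yes ≡0 = ⊥-elim (Fin.punchInᵢ≢i (toFin 0#) j
                       (trans (sym (Inverse.strictlyInverseˡ card _)) (cong toFin ≡0)))

  q≡suc[q-1] : q ≡ suc (pred q)
  q≡suc[q-1] = sym (ℕ.suc-pred q {{Fin.nonZeroIndex (toFin 0#)}})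

  fermat : ∀ x → x ^ q ≡ x
  fermat x with x ≟ 0#
  ... | yes refl = 0^n≡0 q {{Fin.nonZeroIndex (toFin 0#)}}
  ... | no x≢0   = begin
    x ^ q             ≡⟨ cong (x ^_) q≡suc[q-1] ⟩
    x * x ^ pred q    ≡⟨ cong (x *_) (trans (sym (∏scaling-factor≡a^[q-1] q≡suc[q-1])) ∏scaling-factor≡1) ⟩
    x * 1#            ≡⟨ *-identityʳ x ⟩
    x                 ∎
    where open Fermat x≢0

module CharacteristicTwo {q : ℕ} (F : FiniteField q)
                         (1+1≡0 : FiniteField._+_ F (FiniteField.1# F) (FiniteField.1# F) ≡ FiniteField.0# F) where
  open FiniteField F
  open FiniteFieldProperties F
  open ≡-Reasoning

  bit : Bool → Carrier
  bit false = 0#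
  bit true  = 1#

  bit-homomorphism : CommutativeRing.rawRing xor-∧-commutativeRing
                     -Raw-AlmostCommutative⟶ fromCommutativeRing commutativeRing
  bit-homomorphism = record
    { ⟦_⟧    = bit
    ; +-homo = +-homo
    ; *-homo = *-homo
    ; -‿homo = -‿homo
    ; 0-homo = refl
    ; 1-homo = refl
    }
    where
    open GroupProperties +-group using (ε⁻¹≈ε; inverseʳ-unique)
    +-homo : ∀ a b → bit (a xor b) ≡ bit a + bit b
    +-homo false b     = sym (+-identityˡ _)
    +-homo true  false = sym (+-identityʳ _)
    +-homo true  true  = sym 1+1≡0
    *-homo : ∀ a b → bit (a ∧ b) ≡ bit a * bit b
    *-homo false b = sym (zeroˡ _)
    *-homo true  b = sym (*-identityˡ _)
    -‿homo : ∀ a → bit a ≡ - bit a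
    -‿homo false = sym ε⁻¹≈ε
    -‿homo true  = inverseʳ-unique 1# 1# 1+1≡0

  bit-≟ : ∀ a b → Maybe (bit a ≡ bit b)
  bit-≟ a b with a ≟ᵇ b
  ... | yes refl = just refl
  ... | no _     = nothing

  -- A ring solver with coefficients in GF(2), so that it knows 1 + 1 = 0.
  open import Algebra.Solver.Ring
    (CommutativeRing.rawRing xor-∧-commutativeRing) (fromCommutativeRing commutativeRing) bit-homomorphism bit-≟
    public using (solve; _:=_; con; _:+_; _:*_)

  x+x≡0 : ∀ x → x + x ≡ 0#
  x+x≡0 = solve 1 (λ x → x :+ x := con false) refl

  x+y≡0⇒x≡y : ∀ {x y} → x + y ≡ 0# → x ≡ y
  x+y≡0⇒x≡y {x} {y} x+y≡0 = begin
    x              ≡⟨ solve 2 (λ x y → x := (x :+ y) :+ y) refl x y ⟩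
    (x + y) + y    ≡⟨ cong (_+ y) x+y≡0 ⟩
    0# + y         ≡⟨ +-identityˡ y ⟩
    y              ∎

  x≡y⇒x+y≡0 : ∀ {x y} → x ≡ y → x + y ≡ 0#
  x≡y⇒x+y≡0 {x} refl = x+x≡0 x

  frobenius : ℕ → Carrier → Carrier
  frobenius k x = x ^ (2 ^ℕ k)

  frobenius-+ : ∀ k x y → frobenius k (x + y) ≡ frobenius k x + frobenius k y
  frobenius-+ zero    x y = solve 2 (λ x y → (x :+ y) :* con true := x :* con true :+ y :* con true) refl x y
  frobenius-+ (suc k) x y = begin
    frobenius (suc k) (x + y)               ≡⟨ sym (^-assocʳ (x + y) 2 (2 ^ℕ k)) ⟩
    frobenius k ((x + y) ^ 2)               ≡⟨ cong (frobenius k) [x+y]²≡x²+y² ⟩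
    frobenius k (x ^ 2 + y ^ 2)             ≡⟨ frobenius-+ k (x ^ 2) (y ^ 2) ⟩
    frobenius k (x ^ 2) + frobenius k (y ^ 2) ≡⟨ cong₂ _+_ (^-assocʳ x 2 (2 ^ℕ k)) (^-assocʳ y 2 (2 ^ℕ k)) ⟩
    frobenius (suc k) x + frobenius (suc k) y ∎
    where
    [x+y]²≡x²+y² : (x + y) ^ 2 ≡ x ^ 2 + y ^ 2
    [x+y]²≡x²+y² = solve 2 (λ x y → (x :+ y) :* ((x :+ y) :* con true) := x :* (x :* con true) :+ y :* (y :* con true))
                     refl x y

  frobenius-* : ∀ k x y → frobenius k (x * y) ≡ frobenius k x * frobenius k y
  frobenius-* k x y = ^-distrib-* x y (2 ^ℕ k)

  frobenius-1 : ∀ k → frobenius k 1# ≡ 1#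
  frobenius-1 k = 1^n≡1 (2 ^ℕ k)

  frobenius-∘ : ∀ a b x → frobenius a (frobenius b x) ≡ frobenius (b +ℕ a) x
  frobenius-∘ a b x = begin
    (x ^ (2 ^ℕ b)) ^ (2 ^ℕ a)    ≡⟨ ^-assocʳ x (2 ^ℕ b) (2 ^ℕ a) ⟩
    x ^ (2 ^ℕ b *ℕ 2 ^ℕ a)       ≡⟨ cong (x ^_) (sym (ℕ.^-distribˡ-+-* 2 b a)) ⟩
    x ^ (2 ^ℕ (b +ℕ a))          ∎

  data Polynomial : ℕ → (Carrier → Carrier) → Set where
    constant  : ∀ {c} → c ≢ 0# → Polynomial 0 (λ _ → c)
    horner    : ∀ {d g} c → Polynomial d g → Polynomial (suc d) (λ y → c + y * g y)
    pointwise : ∀ {d f g} → (∀ y → f y ≡ g y) → Polynomial d f → Polynomial d g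

  divide-by-linear : ∀ {d g} → Polynomial d g → ∀ c a →
    Σ (Carrier → Carrier) λ h → Polynomial d h × Σ Carrier λ r → ∀ y → c + y * g y ≡ (y + a) * h y + r
  divide-by-linear (constant {l} l≢0) c a =
    (λ _ → l) , constant l≢0 , c + a * l ,
    solve 4 (λ c a l y → c :+ y :* l := (y :+ a) :* l :+ (c :+ a :* l)) refl c a l
  divide-by-linear (horner {g = g′} c′ p) c a with divide-by-linear p c′ a
  ... | h , ph , r , g≡ = (λ y → r + y * h y) , horner r ph , c + a * r , λ y → begin
    c + y * (c′ + y * g′ y)        ≡⟨ cong (λ t → c + y * t) (g≡ y) ⟩
    c + y * ((y + a) * h y + r)    ≡⟨ solve 5 (λ c a r y hy → c :+ y :* ((y :+ a) :* hy :+ r)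
                                                     := (y :+ a) :* (r :+ y :* hy) :+ (c :+ a :* r))
                                        refl c a r y (h y) ⟩
    (y + a) * (r + y * h y) + (c + a * r) ∎
  divide-by-linear (pointwise f≗g p) c a with divide-by-linear p c a
  ... | h , ph , r , f≡ = h , ph , r , λ y → trans (cong (λ t → c + y * t) (sym (f≗g y))) (f≡ y)

  roots-bound : ∀ {d f} → Polynomial d f → ∀ {ys} → Unique ys → All (λ y → f y ≡ 0#) ys → length ys ≤ d
  roots-bound _                 []              []             = z≤n
  roots-bound (constant c≢0)    _               (c≡0 ∷ _)      = ⊥-elim (c≢0 c≡0)
  roots-bound (pointwise f≗g p) distinct        roots          =
    roots-bound p distinct (All.map (λ {y} → trans (f≗g y)) roots)
  roots-bound {f = f} (horner c p) {a ∷ ys} (a≢ys ∷ distinct) (fa≡0 ∷ roots)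
    with divide-by-linear p c a
  ... | h , ph , r , f≡ = s≤s (roots-bound ph distinct (All.zipWith root-of-quotient (a≢ys , roots)))
    where
    r≡0 : r ≡ 0#
    r≡0 = begin
      r                      ≡⟨ solve 3 (λ a ha r → r := (a :+ a) :* ha :+ r) refl a (h a) r ⟩
      (a + a) * h a + r      ≡⟨ sym (f≡ a) ⟩
      f a                    ≡⟨ fa≡0 ⟩
      0#                     ∎
    root-of-quotient : ∀ {b} → a ≢ b × f b ≡ 0# → h b ≡ 0#
    root-of-quotient {b} (a≢b , fb≡0) with x*y≡0⇒x≡0⊎y≡0 (begin
      (b + a) * h b          ≡⟨ sym (+-identityʳ _) ⟩
      (b + a) * h b + 0#     ≡⟨ cong (_ +_) (sym r≡0) ⟩
      (b + a) * h b + r      ≡⟨ sym (f≡ b) ⟩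
      f b                    ≡⟨ fb≡0 ⟩
      0#                     ∎)
    ... | inj₁ b+a≡0 = ⊥-elim (a≢b (sym (x+y≡0⇒x≡y b+a≡0)))
    ... | inj₂ hb≡0  = hb≡0

  root-cover-bound : ∀ {d f g h} → Polynomial d f → Polynomial d g → Polynomial d h →
                      (∀ y → f y ≡ 0# ⊎ g y ≡ 0# ⊎ h y ≡ 0#) → q ≤ d +ℕ (d +ℕ d)
  root-cover-bound {d} {f} {g} {h} pf pg ph covered = subst (_≤ d +ℕ (d +ℕ d)) length-elements
    (ℕ.≤-trans (length-≤-filter-∪ f? g∪h? {elements} (All.tabulate (λ {y} _ → covered y)))
      (ℕ.+-mono-≤ (count pf f? elements-unique)
        (ℕ.≤-trans (length-≤-filter-∪ g? h? {gh} (All.all-filter g∪h? elements))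
          (ℕ.+-mono-≤ (count pg g? gh-unique) (count ph h? gh-unique)))))
    where
    f? : Decidable (λ y → f y ≡ 0#)
    f? y = f y ≟ 0#
    g? : Decidable (λ y → g y ≡ 0#)
    g? y = g y ≟ 0#
    h? : Decidable (λ y → h y ≡ 0#)
    h? y = h y ≟ 0#
    g∪h? : Decidable (λ y → g y ≡ 0# ⊎ h y ≡ 0#)
    g∪h? = g? ∪? h?
    gh : List Carrier
    gh = filter g∪h? elements
    gh-unique : Unique gh
    gh-unique = Unique.filter⁺ g∪h? elements-unique
    count : ∀ {r} → Polynomial d r → (r? : Decidable (λ y → r y ≡ 0#)) →
            ∀ {ys} → Unique ys → length (filter r? ys) ≤ d
    count p r? {ys} distinct = roots-bound p (Unique.filter⁺ r? distinct) (All.all-filter r? ys)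

  power-* : ∀ {d g} k → Polynomial d g → Polynomial (k +ℕ d) (λ y → y ^ k * g y)
  power-* zero    p = pointwise (λ y → sym (*-identityˡ _)) p
  power-* (suc k) p = pointwise (λ y → trans (+-identityˡ _) (sym (*-assoc y _ _))) (horner 0# (power-* k p))

  trinomial : ∀ a b {c} → c ≢ 0# → ∀ {j k} → 2 ≤ j → j < k →
              Polynomial k (λ y → a * y + b * y ^ j + c * y ^ k)
  trinomial a b {c} c≢0 2≤j j<k with ℕ.m≤n⇒∃[o]m+o≡n 2≤j | ℕ.m≤n⇒∃[o]m+o≡n j<k
  ... | s , refl | t , refl =
    subst (λ d → Polynomial d (λ y → a * y + b * y ^ (2 +ℕ s) + c * y ^ (3 +ℕ s +ℕ t))) degree
      (pointwise expand (horner 0# (horner a (power-* s (horner b (power-* t (constant c≢0)))))))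
    where
    degree : 2 +ℕ (s +ℕ suc (t +ℕ 0)) ≡ 3 +ℕ s +ℕ t
    degree = cong (2 +ℕ_) (trans (ℕ.+-suc s (t +ℕ 0)) (cong (λ n → suc (s +ℕ n)) (ℕ.+-identityʳ t)))
    expand : ∀ y → 0# + y * (a + y * (y ^ s * (b + y * (y ^ t * c))))
                 ≡ a * y + b * y ^ (2 +ℕ s) + c * y ^ (3 +ℕ s +ℕ t)
    expand y = begin
      0# + y * (a + y * (y ^ s * (b + y * (y ^ t * c))))
        ≡⟨ solve 6 (λ a b c y u v → con false :+ y :* (a :+ y :* (u :* (b :+ y :* (v :* c))))
                                    := a :* y :+ b :* (y :* (y :* u)) :+ c :* (y :* (y :* (y :* (u :* v)))))
                   refl a b c y (y ^ s) (y ^ t) ⟩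
      a * y + b * y ^ (2 +ℕ s) + c * (y * (y * (y * (y ^ s * y ^ t))))
        ≡⟨ cong (λ e → a * y + b * y ^ (2 +ℕ s) + c * (y * (y * (y * e)))) (sym (^-homo-* y s t)) ⟩
      a * y + b * y ^ (2 +ℕ s) + c * y ^ (3 +ℕ s +ℕ t) ∎

  module Circulant (τ : Carrier → Carrier)
                   (τ-+ : ∀ x y → τ (x + y) ≡ τ x + τ y)
                   (τ-* : ∀ x y → τ (x * y) ≡ τ x * τ y)
                   (τ-1 : τ 1# ≡ 1#)
                   (τ³≡id : ∀ x → τ (τ (τ x)) ≡ x) where

    Fixed : Carrier → Set
    Fixed c = τ c ≡ c

    Fixed-+ : ∀ {x y} → Fixed x → Fixed y → Fixed (x + y)
    Fixed-+ {x} {y} τx≡x τy≡y = trans (τ-+ x y) (cong₂ _+_ τx≡x τy≡y)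

    Fixed-* : ∀ {x y} → Fixed x → Fixed y → Fixed (x * y)
    Fixed-* {x} {y} τx≡x τy≡y = trans (τ-* x y) (cong₂ _*_ τx≡x τy≡y)

    Fixed-inverse : ∀ {x y} → Fixed x → y * x ≡ 1# → Fixed y
    Fixed-inverse {x} {y} τx≡x yx≡1 = *-cancelʳ-≢0 x≢0 (begin
      τ y * x        ≡⟨ cong (τ y *_) (sym τx≡x) ⟩
      τ y * τ x      ≡⟨ sym (τ-* y x) ⟩
      τ (y * x)      ≡⟨ cong τ yx≡1 ⟩
      τ 1#           ≡⟨ τ-1 ⟩
      1#             ≡⟨ sym yx≡1 ⟩
      y * x          ∎)
      where
      x≢0 : x ≢ 0#
      x≢0 x≡0 = 1≢0 (trans (sym yx≡1) (trans (cong (y *_) x≡0) (zeroʳ y)))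

    Coefficients : Set
    Coefficients = Carrier × Carrier × Carrier

    AllFixed : Coefficients → Set
    AllFixed (a , b , c) = Fixed a × Fixed b × Fixed c

    circulant : Coefficients → Carrier → Carrier
    circulant (a , b , c) z = a * z + b * τ z + c * τ (τ z)

    infixl 6 _⊕_
    infixl 7 _⊛_ _·_

    _⊕_ : Coefficients → Coefficients → Coefficients
    (a₀ , a₁ , a₂) ⊕ (b₀ , b₁ , b₂) = a₀ + b₀ , a₁ + b₁ , a₂ + b₂

    _·_ : Carrier → Coefficients → Coefficients
    d · (a₀ , a₁ , a₂) = d * a₀ , d * a₁ , d * a₂

    _⊛_ : Coefficients → Coefficients → Coefficients
    (a₀ , a₁ , a₂) ⊛ (b₀ , b₁ , b₂) =
      a₀ * b₀ + a₁ * b₂ + a₂ * b₁ , a₀ * b₁ + a₁ * b₀ + a₂ * b₂ , a₀ * b₂ + a₁ * b₁ + a₂ * b₀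

    circulant-cong : ∀ {u v} → u ≡ v → ∀ z → circulant u z ≡ circulant v z
    circulant-cong refl z = refl

    circulant-id : ∀ z → circulant (1# , 0# , 0#) z ≡ z
    circulant-id z = solve 3 (λ z τz τ²z → con true :* z :+ con false :* τz :+ con false :* τ²z := z)
                       refl z (τ z) (τ (τ z))

    circulant-⊕ : ∀ u v z → circulant u z + circulant v z ≡ circulant (u ⊕ v) z
    circulant-⊕ (a₀ , a₁ , a₂) (b₀ , b₁ , b₂) z =
      solve 9 (λ a₀ a₁ a₂ b₀ b₁ b₂ z τz τ²z →
                 (a₀ :* z :+ a₁ :* τz :+ a₂ :* τ²z) :+ (b₀ :* z :+ b₁ :* τz :+ b₂ :* τ²z)
              := (a₀ :+ b₀) :* z :+ (a₁ :+ b₁) :* τz :+ (a₂ :+ b₂) :* τ²z)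
        refl a₀ a₁ a₂ b₀ b₁ b₂ z (τ z) (τ (τ z))

    τ-circulant : ∀ {a b c} → AllFixed (a , b , c) → ∀ z → τ (circulant (a , b , c) z) ≡ circulant (c , a , b) z
    τ-circulant {a} {b} {c} (τa≡a , τb≡b , τc≡c) z = begin
      τ (a * z + b * τ z + c * τ (τ z))          ≡⟨ trans (τ-+ _ _) (cong (τ (a * z + b * τ z) +_) (τ-* c _)) ⟩
      τ (a * z + b * τ z) + τ c * τ (τ (τ z))    ≡⟨ cong₂ _+_ (τ-+ _ _) (cong₂ _*_ τc≡c (τ³≡id z)) ⟩
      τ (a * z) + τ (b * τ z) + c * z            ≡⟨ cong₂ (λ s t → s + t + c * z) (τ-* a z) (τ-* b (τ z)) ⟩
      τ a * τ z + τ b * τ (τ z) + c * z          ≡⟨ cong₂ (λ s t → s * τ z + t * τ (τ z) + c * z) τa≡a τb≡b ⟩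
      a * τ z + b * τ (τ z) + c * z              ≡⟨ solve 6 (λ a b c z τz τ²z → a :* τz :+ b :* τ²z :+ c :* z
                                                                            := c :* z :+ a :* τz :+ b :* τ²z)
                                                      refl a b c z (τ z) (τ (τ z)) ⟩
      c * z + a * τ z + b * τ (τ z)              ∎

    circulant-∘ : ∀ u {v} → AllFixed v → ∀ z → circulant u (circulant v z) ≡ circulant (u ⊛ v) z
    circulant-∘ (a₀ , a₁ , a₂) {b₀ , b₁ , b₂} fixed@(τb₀≡b₀ , τb₁≡b₁ , τb₂≡b₂) z = begin
      a₀ * V z + a₁ * τ (V z) + a₂ * τ (τ (V z))
        ≡⟨ cong₂ (λ s t → a₀ * V z + a₁ * s + a₂ * t) (τ-circulant fixed z)
                 (trans (cong τ (τ-circulant fixed z)) (τ-circulant (τb₂≡b₂ , τb₀≡b₀ , τb₁≡b₁) z)) ⟩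
      a₀ * V z + a₁ * circulant (b₂ , b₀ , b₁) z + a₂ * circulant (b₁ , b₂ , b₀) z
        ≡⟨ solve 9 (λ a₀ a₁ a₂ b₀ b₁ b₂ z τz τ²z →
                      a₀ :* (b₀ :* z :+ b₁ :* τz :+ b₂ :* τ²z) :+ a₁ :* (b₂ :* z :+ b₀ :* τz :+ b₁ :* τ²z)
                        :+ a₂ :* (b₁ :* z :+ b₂ :* τz :+ b₀ :* τ²z)
                   := (a₀ :* b₀ :+ a₁ :* b₂ :+ a₂ :* b₁) :* z :+ (a₀ :* b₁ :+ a₁ :* b₀ :+ a₂ :* b₂) :* τz
                        :+ (a₀ :* b₂ :+ a₁ :* b₁ :+ a₂ :* b₀) :* τ²z)
             refl a₀ a₁ a₂ b₀ b₁ b₂ z (τ z) (τ (τ z)) ⟩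
      circulant ((a₀ , a₁ , a₂) ⊛ (b₀ , b₁ , b₂)) z ∎
      where
      V : Carrier → Carrier
      V = circulant (b₀ , b₁ , b₂)

    ⊛-comm : ∀ u v → u ⊛ v ≡ v ⊛ u
    ⊛-comm (a₀ , a₁ , a₂) (b₀ , b₁ , b₂) = cong₂ _,_
      (solve 6 (λ a₀ a₁ a₂ b₀ b₁ b₂ → a₀ :* b₀ :+ a₁ :* b₂ :+ a₂ :* b₁ := b₀ :* a₀ :+ b₁ :* a₂ :+ b₂ :* a₁)
         refl a₀ a₁ a₂ b₀ b₁ b₂)
      (cong₂ _,_
        (solve 6 (λ a₀ a₁ a₂ b₀ b₁ b₂ → a₀ :* b₁ :+ a₁ :* b₀ :+ a₂ :* b₂ := b₀ :* a₁ :+ b₁ :* a₀ :+ b₂ :* a₂)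
           refl a₀ a₁ a₂ b₀ b₁ b₂)
        (solve 6 (λ a₀ a₁ a₂ b₀ b₁ b₂ → a₀ :* b₂ :+ a₁ :* b₁ :+ a₂ :* b₀ := b₀ :* a₂ :+ b₁ :* a₁ :+ b₂ :* a₀)
           refl a₀ a₁ a₂ b₀ b₁ b₂))

    -- The circulant determinant a³ + b³ + c³ − 3abc, written in characteristic 2.
    det : Coefficients → Carrier
    det (a , b , c) = a * a * a + b * b * b + c * c * c + a * b * c

    det-swap : ∀ a b c → det (a , b , c) ≡ det (c , b , a)
    det-swap = solve 3 (λ a b c → a :* a :* a :+ b :* b :* b :+ c :* c :* c :+ a :* b :* c
                               := c :* c :* c :+ b :* b :* b :+ a :* a :* a :+ c :* b :* a) refl

    adj : Coefficients → Coefficients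
    adj (a , b , c) = a * a + b * c , c * c + a * b , b * b + a * c

    ⊛-adj : ∀ u d → u ⊛ (d · adj u) ≡ (d * det u , 0# , 0#)
    ⊛-adj (a , b , c) d = cong₂ _,_
      (solve 4 (λ a b c d → a :* (d :* (a :* a :+ b :* c)) :+ b :* (d :* (b :* b :+ a :* c)) :+ c :* (d :* (c :* c :+ a :* b))
                         := d :* (a :* a :* a :+ b :* b :* b :+ c :* c :* c :+ a :* b :* c))
         refl a b c d)
      (cong₂ _,_
        (solve 4 (λ a b c d → a :* (d :* (c :* c :+ a :* b)) :+ b :* (d :* (a :* a :+ b :* c)) :+ c :* (d :* (b :* b :+ a :* c))
                           := con false)
           refl a b c d)
        (solve 4 (λ a b c d → a :* (d :* (b :* b :+ a :* c)) :+ b :* (d :* (c :* c :+ a :* b)) :+ c :* (d :* (a :* a :+ b :* c))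
                           := con false)
           refl a b c d))

    AllFixed-·adj : ∀ {u d} → AllFixed u → Fixed d → AllFixed (d · adj u)
    AllFixed-·adj (fa , fb , fc) fd =
      Fixed-* fd (Fixed-+ (Fixed-* fa fa) (Fixed-* fb fc)) ,
      Fixed-* fd (Fixed-+ (Fixed-* fc fc) (Fixed-* fa fb)) ,
      Fixed-* fd (Fixed-+ (Fixed-* fb fb) (Fixed-* fa fc))

    circulant-inverse : ∀ {u d} → AllFixed u → Fixed d → d * det u ≡ 1# →
                        InverseOf (circulant (d · adj u)) (circulant u)
    circulant-inverse {u} {d} fixed fd d*det≡1 = left , right
      where
      right : ∀ z → circulant u (circulant (d · adj u) z) ≡ z
      right z = begin
        circulant u (circulant (d · adj u) z)   ≡⟨ circulant-∘ u (AllFixed-·adj fixed fd) z ⟩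
        circulant (u ⊛ (d · adj u)) z           ≡⟨ circulant-cong (trans (⊛-adj u d) (cong (_, 0# , 0#) d*det≡1)) z ⟩
        circulant (1# , 0# , 0#) z              ≡⟨ circulant-id z ⟩
        z                                       ∎
      left : ∀ z → circulant (d · adj u) (circulant u z) ≡ z
      left z = begin
        circulant (d · adj u) (circulant u z)   ≡⟨ circulant-∘ (d · adj u) fixed z ⟩
        circulant ((d · adj u) ⊛ u) z           ≡⟨ circulant-cong (⊛-comm (d · adj u) u) z ⟩
        circulant (u ⊛ (d · adj u)) z           ≡⟨ sym (circulant-∘ u (AllFixed-·adj fixed fd) z) ⟩
        circulant u (circulant (d · adj u) z)   ≡⟨ right z ⟩
        z                                       ∎

4≤2^[2m] : ∀ {m} → 1 ≤ m → 4 ≤ 2 ^ℕ (2 *ℕ m)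
4≤2^[2m] 1≤m = ℕ.^-monoʳ-≤ 2 (ℕ.*-monoʳ-≤ 2 1≤m)

3·2^[4m]<2^[6m] : ∀ {m} → 1 ≤ m → 2 ^ℕ (4 *ℕ m) +ℕ (2 ^ℕ (4 *ℕ m) +ℕ 2 ^ℕ (4 *ℕ m)) < 2 ^ℕ (6 *ℕ m)
3·2^[4m]<2^[6m] {m} 1≤m = begin-strict
  N +ℕ (N +ℕ N)             <⟨ ℕ.m<m+n (N +ℕ (N +ℕ N)) (ℕ.m^n>0 2 (4 *ℕ m)) ⟩
  N +ℕ (N +ℕ N) +ℕ N        ≡⟨ n+[n+n]+n≡4n N ⟩
  4 *ℕ N                    ≤⟨ ℕ.*-monoˡ-≤ N (4≤2^[2m] 1≤m) ⟩
  2 ^ℕ (2 *ℕ m) *ℕ N        ≡⟨ sym (ℕ.^-distribˡ-+-* 2 (2 *ℕ m) (4 *ℕ m)) ⟩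
  2 ^ℕ (2 *ℕ m +ℕ 4 *ℕ m)   ≡⟨ cong (2 ^ℕ_) 2m+4m≡6m ⟩
  2 ^ℕ (6 *ℕ m)             ∎
  where
  open ℕ.≤-Reasoning
  N : ℕ
  N = 2 ^ℕ (4 *ℕ m)
  n+[n+n]+n≡4n : ∀ n → n +ℕ (n +ℕ n) +ℕ n ≡ 4 *ℕ n
  n+[n+n]+n≡4n n = solveℕ (n List.∷ List.[])
  2m+4m≡6m : 2 *ℕ m +ℕ 4 *ℕ m ≡ 6 *ℕ m
  2m+4m≡6m = solveℕ (m List.∷ List.[])

module FieldOfOrder2^6m (m : ℕ) (F : FiniteField (2 ^ℕ (6 *ℕ m))) where
  open FiniteField F
  open FiniteFieldProperties F
  open CharacteristicTwo F (characteristic-two {6 *ℕ m} refl)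
  open ≡-Reasoning

  frobenius-∘-≡ : ∀ a b c → b +ℕ a ≡ c → ∀ x → frobenius a (frobenius b x) ≡ frobenius c x
  frobenius-∘-≡ a b _ refl = frobenius-∘ a b

  σ σ⁻¹ τ : Carrier → Carrier
  σ   = frobenius m
  σ⁻¹ = frobenius (5 *ℕ m)
  τ   = frobenius (2 *ℕ m)

  σ-inverse : InverseOf σ⁻¹ σ
  σ-inverse = (λ x → trans (frobenius-∘-≡ (5 *ℕ m) m (6 *ℕ m) (solveℕ (m List.∷ List.[])) x) (fermat x))
            , (λ x → trans (frobenius-∘-≡ m (5 *ℕ m) (6 *ℕ m) (solveℕ (m List.∷ List.[])) x) (fermat x))

  τ³≡id : ∀ x → τ (τ (τ x)) ≡ x
  τ³≡id x = begin
    τ (τ (τ x))                          ≡⟨ cong τ (frobenius-∘ (2 *ℕ m) (2 *ℕ m) x) ⟩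
    τ (frobenius (2 *ℕ m +ℕ 2 *ℕ m) x)   ≡⟨ frobenius-∘-≡ (2 *ℕ m) (2 *ℕ m +ℕ 2 *ℕ m) (6 *ℕ m) (solveℕ (m List.∷ List.[])) x ⟩
    frobenius (6 *ℕ m) x                 ≡⟨ fermat x ⟩
    x                                    ∎

  ^[2^3m]≡τσ : ∀ x → x ^ (2 ^ℕ (3 *ℕ m)) ≡ τ (σ x)
  ^[2^3m]≡τσ x = sym (frobenius-∘-≡ (2 *ℕ m) m (3 *ℕ m) (solveℕ (m List.∷ List.[])) x)

  ^[2^5m]≡ττσ : ∀ x → x ^ (2 ^ℕ (5 *ℕ m)) ≡ τ (τ (σ x))
  ^[2^5m]≡ττσ x = sym (begin
    τ (τ (σ x))                     ≡⟨ cong τ (frobenius-∘ (2 *ℕ m) m x) ⟩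
    τ (frobenius (m +ℕ 2 *ℕ m) x)   ≡⟨ frobenius-∘-≡ (2 *ℕ m) (m +ℕ 2 *ℕ m) (5 *ℕ m) (solveℕ (m List.∷ List.[])) x ⟩
    x ^ (2 ^ℕ (5 *ℕ m))             ∎)

  σ⁻¹τ≡σ : ∀ y → σ⁻¹ (τ y) ≡ σ y
  σ⁻¹τ≡σ y = begin
    σ⁻¹ (τ y)                   ≡⟨ frobenius-∘-≡ (5 *ℕ m) (2 *ℕ m) (m +ℕ 6 *ℕ m) (solveℕ (m List.∷ List.[])) y ⟩
    frobenius (m +ℕ 6 *ℕ m) y   ≡⟨ sym (frobenius-∘ (6 *ℕ m) m y) ⟩
    frobenius (6 *ℕ m) (σ y)    ≡⟨ fermat (σ y) ⟩
    σ y                         ∎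

  open Circulant τ (frobenius-+ (2 *ℕ m)) (frobenius-* (2 *ℕ m)) (frobenius-1 (2 *ℕ m)) τ³≡id

  circulant∘σ : ∀ a b c x →
                circulant (a , b , c) (σ x) ≡ a * x ^ (2 ^ℕ m) + b * x ^ (2 ^ℕ (3 *ℕ m)) + c * x ^ (2 ^ℕ (5 *ℕ m))
  circulant∘σ a b c x = sym (cong₂ (λ s t → a * σ x + b * s + c * t) (^[2^3m]≡τσ x) (^[2^5m]≡ττσ x))

  circulant-polynomial : 1 ≤ m → ∀ {a b c} → c ≢ 0# → Polynomial (2 ^ℕ (4 *ℕ m)) (circulant (a , b , c))
  circulant-polynomial 1≤m {a} {b} {c} c≢0 =
    pointwise (λ y → cong (λ t → a * y + b * τ y + c * t) (sym (frobenius-∘-≡ (2 *ℕ m) (2 *ℕ m) (4 *ℕ m) 2m+2m≡4m y)))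
      (trinomial a b c≢0 (ℕ.≤-trans (s≤s (s≤s z≤n)) (4≤2^[2m] 1≤m)) M<N)
    where
    M N : ℕ
    M = 2 ^ℕ (2 *ℕ m)
    N = 2 ^ℕ (4 *ℕ m)
    2m+2m≡4m : 2 *ℕ m +ℕ 2 *ℕ m ≡ 4 *ℕ m
    2m+2m≡4m = solveℕ (m List.∷ List.[])
    M<N : M < N
    M<N = subst (M <_) (trans (sym (ℕ.^-distribˡ-+-* 2 (2 *ℕ m) (2 *ℕ m))) (cong (2 ^ℕ_) 2m+2m≡4m))
            (ℕ.m<m*n M M {{ℕ.m^n≢0 2 (2 *ℕ m)}} (ℕ.<-≤-trans (s≤s (s≤s z≤n)) (4≤2^[2m] 1≤m)))

  α-condition₁⇒α≢0 : 1 ≤ m → ∀ {α} → α ^ (2 ^ℕ m) + α ^ (2 ^ℕ m ∸ 1) + 1# ≡ 0# → α ≢ 0#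
  α-condition₁⇒α≢0 1≤m condition refl = 1≢0 (begin
    1#                                        ≡⟨ solve 0 (con true := con false :+ con false :+ con true) refl ⟩
    0# + 0# + 1#                              ≡⟨ sym (cong₂ (λ s t → s + t + 1#) (0^n≡0 (2 ^ℕ m) {{ℕ.m^n≢0 2 m}})
                                                                               (0^n≡0 (2 ^ℕ m ∸ 1) {{2^m∸1≢0}})) ⟩
    0# ^ (2 ^ℕ m) + 0# ^ (2 ^ℕ m ∸ 1) + 1#    ≡⟨ condition ⟩
    0#                                        ∎)
    where
    2^m∸1≢0 : NonZero (2 ^ℕ m ∸ 1)
    2^m∸1≢0 = >-nonZero (ℕ.∸-monoˡ-≤ 1 (ℕ.^-monoʳ-≤ 2 1≤m))

  α-condition₁⇒α≢1 : ∀ {α} → α ^ (2 ^ℕ m) + α ^ (2 ^ℕ m ∸ 1) + 1# ≡ 0# → α ≢ 1#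
  α-condition₁⇒α≢1 condition refl = 1≢0 (begin
    1#                                        ≡⟨ solve 0 (con true := con true :+ con true :+ con true) refl ⟩
    1# + 1# + 1#                              ≡⟨ sym (cong₂ (λ s t → s + t + 1#) (1^n≡1 (2 ^ℕ m)) (1^n≡1 (2 ^ℕ m ∸ 1))) ⟩
    1# ^ (2 ^ℕ m) + 1# ^ (2 ^ℕ m ∸ 1) + 1#    ≡⟨ condition ⟩
    0#                                        ∎)

  α-condition₂⇒α≢0 : ∀ {α} → α ^ (2 ^ℕ m +ℕ 1) ≡ 1# → α ≢ 0#
  α-condition₂⇒α≢0 condition refl =
    0≢1 (trans (sym (0^n≡0 (2 ^ℕ m +ℕ 1) {{>-nonZero (ℕ.m≤n+m 1 (2 ^ℕ m))}})) condition)

  β+1≢0 : ∀ {α β} → α ≢ 0# → α ≢ 1# → β ≡ α ⊎ β ≡ α + 1# → β + 1# ≢ 0#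
  β+1≢0     α≢0 α≢1 (inj₁ refl) = α≢1 ∘ x+y≡0⇒x≡y
  β+1≢0 {α} α≢0 α≢1 (inj₂ refl) = α≢0 ∘ trans (solve 1 (λ a → a := a :+ con true :+ con true) refl α)

  -- For other β the determinant is (β + 1)(β + α)(β + α + 1) + β + 1.
  det[α,β,α+1]≡β+1 : ∀ {α β} → β ≡ α ⊎ β ≡ α + 1# → det (α , β , α + 1#) ≡ β + 1#
  det[α,β,α+1]≡β+1 {α} (inj₁ refl) =
    solve 1 (λ a → a :* a :* a :+ a :* a :* a :+ (a :+ con true) :* (a :+ con true) :* (a :+ con true)
                   :+ a :* a :* (a :+ con true)
                 := a :+ con true)
      refl α
  det[α,β,α+1]≡β+1 {α} (inj₂ refl) =
    solve 1 (λ a → a :* a :* a :+ (a :+ con true) :* (a :+ con true) :* (a :+ con true)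
                   :+ (a :+ con true) :* (a :+ con true) :* (a :+ con true) :+ a :* (a :+ con true) :* (a :+ con true)
                 := a :+ con true :+ con true)
      refl α

  module PermutationTriple (α β : Carrier) (α-fixed : Fixed α) (β-fixed : Fixed β)
                           (α≢0 : α ≢ 0#) (α≢1 : α ≢ 1#) (β≡α⊎β≡α+1 : β ≡ α ⊎ β ≡ α + 1#) where

    Φ₁ Φ₂ Φ₃ : Carrier → Carrier
    Φ₁ x = x ^ (2 ^ℕ m)
    Φ₂ x = α * x ^ (2 ^ℕ m) + β * x ^ (2 ^ℕ (3 *ℕ m)) + (α + 1#) * x ^ (2 ^ℕ (5 *ℕ m))
    Φ₃ x = (α + 1#) * x ^ (2 ^ℕ m) + β * x ^ (2 ^ℕ (3 *ℕ m)) + α * x ^ (2 ^ℕ (5 *ℕ m))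

    L₁ L₂ L₃ : Coefficients
    L₁ = 1# , 0# , 0#
    L₂ = α , β , α + 1#
    L₃ = α + 1# , β , α

    Φ₁≡L₁∘σ : ∀ x → Φ₁ x ≡ circulant L₁ (σ x)
    Φ₁≡L₁∘σ x = sym (circulant-id (σ x))

    Φ₂≡L₂∘σ : ∀ x → Φ₂ x ≡ circulant L₂ (σ x)
    Φ₂≡L₂∘σ x = sym (circulant∘σ α β (α + 1#) x)

    Φ₃≡L₃∘σ : ∀ x → Φ₃ x ≡ circulant L₃ (σ x)
    Φ₃≡L₃∘σ x = sym (circulant∘σ (α + 1#) β α x)

    det-L₂ : det L₂ ≡ β + 1#
    det-L₂ = det[α,β,α+1]≡β+1 β≡α⊎β≡α+1

    det-L₃ : det L₃ ≡ β + 1#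
    det-L₃ = trans (det-swap (α + 1#) β α) det-L₂

    β+1-inverse : Σ Carrier λ y → (β + 1#) * y ≡ 1#
    β+1-inverse = inverse (β + 1#) (β+1≢0 α≢0 α≢1 β≡α⊎β≡α+1)

    D : Carrier
    D = proj₁ β+1-inverse

    D*[β+1]≡1 : D * (β + 1#) ≡ 1#
    D*[β+1]≡1 = trans (*-comm D (β + 1#)) (proj₂ β+1-inverse)

    α+1-fixed : Fixed (α + 1#)
    α+1-fixed = Fixed-+ α-fixed (frobenius-1 (2 *ℕ m))

    D-fixed : Fixed D
    D-fixed = Fixed-inverse (Fixed-+ β-fixed (frobenius-1 (2 *ℕ m))) D*[β+1]≡1

    Φ₂⁻¹ Φ₃⁻¹ : Carrier → Carrier
    Φ₂⁻¹ = σ⁻¹ ∘ circulant (D · adj L₂)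
    Φ₃⁻¹ = σ⁻¹ ∘ circulant (D · adj L₃)

    Φ₂-inverse : InverseOf Φ₂⁻¹ Φ₂
    Φ₂-inverse = InverseOf-≗ (λ x → sym (Φ₂≡L₂∘σ x))
      (InverseOf-∘ {f = σ} {σ⁻¹} {circulant L₂} σ-inverse
        (circulant-inverse (α-fixed , β-fixed , α+1-fixed) D-fixed (trans (cong (D *_) det-L₂) D*[β+1]≡1)))

    Φ₃-inverse : InverseOf Φ₃⁻¹ Φ₃
    Φ₃-inverse = InverseOf-≗ (λ x → sym (Φ₃≡L₃∘σ x))
      (InverseOf-∘ {f = σ} {σ⁻¹} {circulant L₃} σ-inverse
        (circulant-inverse (α+1-fixed , β-fixed , α-fixed) D-fixed (trans (cong (D *_) det-L₃) D*[β+1]≡1)))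

    Ψ≡σ⁻¹ : ∀ x → Sum3 Φ₁ Φ₂ Φ₃ x ≡ σ⁻¹ x
    Ψ≡σ⁻¹ x = solve 5 (λ a b u v w → u :+ (a :* u :+ b :* v :+ (a :+ con true) :* w)
                                       :+ ((a :+ con true) :* u :+ b :* v :+ a :* w)
                                    := w)
                refl α β (x ^ (2 ^ℕ m)) (x ^ (2 ^ℕ (3 *ℕ m))) (x ^ (2 ^ℕ (5 *ℕ m)))

    Ψ-inverse : InverseOf σ (Sum3 Φ₁ Φ₂ Φ₃)
    Ψ-inverse = InverseOf-≗ (λ x → sym (Ψ≡σ⁻¹ x)) (proj₂ σ-inverse , proj₁ σ-inverse)

    y+L₂⁻¹y+L₃⁻¹y≡τy : ∀ y → y + circulant (D · adj L₂) y + circulant (D · adj L₃) y ≡ τ y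
    y+L₂⁻¹y+L₃⁻¹y≡τy y = begin
      y + circulant (D · adj L₂) y + circulant (D · adj L₃) y
        ≡⟨ solve 6 (λ a b d y τy τ²y →
              y :+ (d :* (a :* a :+ b :* (a :+ con true)) :* y :+ d :* ((a :+ con true) :* (a :+ con true) :+ a :* b) :* τy
                      :+ d :* (b :* b :+ a :* (a :+ con true)) :* τ²y)
                :+ (d :* ((a :+ con true) :* (a :+ con true) :+ b :* a) :* y :+ d :* (a :* a :+ (a :+ con true) :* b) :* τy
                      :+ d :* (b :* b :+ (a :+ con true) :* a) :* τ²y)
              := y :+ d :* (b :+ con true) :* y :+ d :* (b :+ con true) :* τy)
            refl α β D y (τ y) (τ (τ y)) ⟩
      y + D * (β + 1#) * y + D * (β + 1#) * τ y
        ≡⟨ cong (λ e → y + e * y + e * τ y) D*[β+1]≡1 ⟩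
      y + 1# * y + 1# * τ y
        ≡⟨ solve 2 (λ y τy → y :+ con true :* y :+ con true :* τy := τy) refl y (τ y) ⟩
      τ y ∎

    inverse-of-sum : ∀ y → σ y ≡ σ⁻¹ y + Φ₂⁻¹ y + Φ₃⁻¹ y
    inverse-of-sum y = begin
      σ y                                                             ≡⟨ sym (σ⁻¹τ≡σ y) ⟩
      σ⁻¹ (τ y)                                                       ≡⟨ cong σ⁻¹ (sym (y+L₂⁻¹y+L₃⁻¹y≡τy y)) ⟩
      σ⁻¹ (y + circulant (D · adj L₂) y + circulant (D · adj L₃) y)   ≡⟨ frobenius-+ (5 *ℕ m) _ _ ⟩
      σ⁻¹ (y + circulant (D · adj L₂) y) + Φ₃⁻¹ y                     ≡⟨ cong (_+ Φ₃⁻¹ y) (frobenius-+ (5 *ℕ m) _ _) ⟩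
      σ⁻¹ y + Φ₂⁻¹ y + Φ₃⁻¹ y                                         ∎

    property-A : PropertyA Φ₁ Φ₂ Φ₃
    property-A = InverseOf⇒IsPermutation Ψ-inverse
               , σ⁻¹ , Φ₂⁻¹ , Φ₃⁻¹ , σ , σ-inverse , Φ₂-inverse , Φ₃-inverse , Ψ-inverse , inverse-of-sum

    not-covered : 1 ≤ m → ¬ (∀ x → InEUnion Φ₁ Φ₂ Φ₃ x)
    not-covered 1≤m covered = ℕ.<⇒≱ (3·2^[4m]<2^[6m] 1≤m)
      (root-cover-bound (circulant-polynomial 1≤m lead₁₂≢0) (circulant-polynomial 1≤m lead₁₃≢0)
                        (circulant-polynomial 1≤m lead₂₃≢0) cover)
      where
      lead₁₂≢0 : 0# + (α + 1#) ≢ 0#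
      lead₁₂≢0 = α≢1 ∘ x+y≡0⇒x≡y ∘ trans (sym (+-identityˡ _))
      lead₁₃≢0 : 0# + α ≢ 0#
      lead₁₃≢0 = α≢0 ∘ trans (sym (+-identityˡ α))
      lead₂₃≢0 : (α + 1#) + α ≢ 0#
      lead₂₃≢0 = 1≢0 ∘ trans (solve 1 (λ a → con true := (a :+ con true) :+ a) refl α)
      root : ∀ {u v} (Φ Φ′ : Carrier → Carrier) y →
             (∀ x → Φ x ≡ circulant u (σ x)) → (∀ x → Φ′ x ≡ circulant v (σ x)) →
             Φ (σ⁻¹ y) ≡ Φ′ (σ⁻¹ y) → circulant (u ⊕ v) y ≡ 0#
      root {u} {v} Φ Φ′ y Φ≡ Φ′≡ e = subst (λ z → circulant (u ⊕ v) z ≡ 0#) (proj₂ σ-inverse y)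
        (trans (sym (circulant-⊕ u v _)) (x≡y⇒x+y≡0 (trans (sym (Φ≡ _)) (trans e (Φ′≡ _)))))
      cover : ∀ y → circulant (L₁ ⊕ L₂) y ≡ 0# ⊎ circulant (L₁ ⊕ L₃) y ≡ 0#
                                           ⊎ circulant (L₂ ⊕ L₃) y ≡ 0#
      cover y with covered (σ⁻¹ y)
      ... | inj₁ e₁₂        = inj₁ (root Φ₁ Φ₂ y Φ₁≡L₁∘σ Φ₂≡L₂∘σ e₁₂)
      ... | inj₂ (inj₁ e₁₃) = inj₂ (inj₁ (root Φ₁ Φ₃ y Φ₁≡L₁∘σ Φ₃≡L₃∘σ e₁₃))
      ... | inj₂ (inj₂ e₂₃) = inj₂ (inj₂ (root Φ₂ Φ₃ y Φ₂≡L₂∘σ Φ₃≡L₃∘σ e₂₃))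

mainTheorem5 : (m : ℕ) → 1 ≤ m → (F : FiniteField (2 ^ℕ (6 *ℕ m))) →
    let open FiniteField F renaming (_^_ to _^F_) in
    (α β : Carrier) → α ^F (2 ^ℕ (2 *ℕ m)) ≡ α → β ^F (2 ^ℕ (2 *ℕ m)) ≡ β →
    ((α ≡ β × α ^F (2 ^ℕ m) + α ^F (2 ^ℕ m ∸ 1) + 1# ≡ 0#)
      ⊎ (β ≡ α + 1# × α ^F (2 ^ℕ m +ℕ 1) ≡ 1# × α ≢ 1#)) →
    let Φ₁ = λ x → x ^F (2 ^ℕ m)
        Φ₂ = λ x → α * x ^F (2 ^ℕ m) + β * x ^F (2 ^ℕ (3 *ℕ m)) + (α + 1#) * x ^F (2 ^ℕ (5 *ℕ m))
        Φ₃ = λ x → (α + 1#) * x ^F (2 ^ℕ m) + β * x ^F (2 ^ℕ (3 *ℕ m)) + α * x ^F (2 ^ℕ (5 *ℕ m))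
    in IsPermutation Φ₁ × IsPermutation Φ₂ × IsPermutation Φ₃ ×
       PropertyA Φ₁ Φ₂ Φ₃ × ¬ (∀ x → InEUnion Φ₁ Φ₂ Φ₃ x)
mainTheorem5 m 1≤m F α β α-fixed β-fixed conditions =
  InverseOf⇒IsPermutation σ-inverse , InverseOf⇒IsPermutation Φ₂-inverse , InverseOf⇒IsPermutation Φ₃-inverse ,
  property-A , not-covered 1≤m
  where
  open FiniteField F
  open FiniteFieldProperties F using (InverseOf⇒IsPermutation)
  open FieldOfOrder2^6m m F
  α≢0 : α ≢ 0#
  α≢0 = [ α-condition₁⇒α≢0 1≤m ∘ proj₂ , α-condition₂⇒α≢0 ∘ proj₁ ∘ proj₂ ]′ conditions
  α≢1 : α ≢ 1#
  α≢1 = [ α-condition₁⇒α≢1 ∘ proj₂ , proj₂ ∘ proj₂ ]′ conditions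
  β≡α⊎β≡α+1 : β ≡ α ⊎ β ≡ α + 1#
  β≡α⊎β≡α+1 = Sum.map (sym ∘ proj₁) proj₁ conditions
  open PermutationTriple α β α-fixed β-fixed α≢0 α≢1 β≡α⊎β≡α+1
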